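{- For every integer $d\ge1$, $\kappa(d)\le\kappa(d+1)$ in the extended reals $\mathbb{R}\cup\{\infty\}$.
   Context: All simplicial complexes are finite. For a simplicial complex $\Delta$ of dimension $d$, let $F$ be its set of $d$-simplices and $R$ its set of $(d-1)$-simplices; fix orientations and let $\partial\in\mathbb{Z}^{R\times F}$ be the simplicial boundary matrix. A $q$-flow is $\varphi\in\{0,\dots,q-1\}^F$ with $\partial\varphi\equiv0\pmod q$, nowhere-zero if all entries are nonzero. Homology is reduced, $\beta_n(Y)=\operatorname{rank}H_n(Y;\mathbb{Z})$; for $X\subseteq F$, $\Delta\setminus X$ is the subcomplex formed by the facets in $F\setminus X$ and all simplices of dimension $\le d-1$. A facet $f$ is a bridge if $\beta_{d-1}(\Delta\setminus\{f\})=\beta_{d-1}(\Delta)+1$; $\Delta$ is bridgeless if it has no bridge. $\kappa(d)$ is the infimum of all real $\kappa$ such that every bridgeless simplicial complex of dimension $d$ has a nowhere-zero $q$-flow for some positive integer $q\le\kappa$ (with $\inf\emptyset=\infty$). -}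

module Defs where

open import Data.Bool using (Bool; true; false; _∧_; not)
open import Data.Nat using (ℕ; zero; suc; _≤_; _<_; _∸_; _≡ᵇ_; _+_)
open import Data.Integer as ℤ using (ℤ; +_)
open import Data.Integer.Divisibility using () renaming (_∣_ to _∣ℤ_)
open import Data.Fin.Subset using (Subset; _⊆_; ∣_∣)
open import Data.Vec using (Vec; []; _∷_)
open import Data.List using (List; []; _∷_; map; _++_; filterᵇ; length)
open import Data.List.Membership.Propositional using (_∈_)
open import Data.List.Relation.Unary.All using (All)
open import Data.List.Relation.Unary.Unique.Propositional using (Unique)
open import Data.Product using (Σ; ∃; _×_)
open import Relation.Binary.PropositionalEquality using (_≡_)
open import Relation.Nullary using (¬_)

-- A simplex is a subset of Fin n (a simplex with k+1 vertices has
-- dimension k; the empty set is the (-1)-dimensional face, which gives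
-- the augmentation, i.e. reduced homology).

Cx : ℕ → Set
Cx n = Subset n → Bool

IsComplex : ∀ {n} → Cx n → Set
IsComplex {n} K = ∀ (σ τ : Subset n) → σ ⊆ τ → K τ ≡ true → K σ ≡ true

allSubsets : (n : ℕ) → List (Subset n)
allSubsets zero    = [] ∷ []
allSubsets (suc n) = map (false ∷_) (allSubsets n) ++ map (true ∷_) (allSubsets n)

-- faces of K with exactly s vertices (i.e. of dimension s - 1)
facesOfSize : ∀ {n} → Cx n → ℕ → List (Subset n)
facesOfSize {n} K s = filterᵇ (λ σ → K σ ∧ (∣ σ ∣ ≡ᵇ s)) (allSubsets n)

HasDim : ∀ {n} → Cx n → ℕ → Set
HasDim {n} K d =
  (∃ λ (σ : Subset n) → (K σ ≡ true) × (∣ σ ∣ ≡ suc d))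
  × (∀ (σ : Subset n) → K σ ≡ true → ∣ σ ∣ ≤ suc d)

eqSub : ∀ {n} → Subset n → Subset n → Bool
eqSub [] [] = true
eqSub (true ∷ x) (true ∷ y) = eqSub x y
eqSub (false ∷ x) (false ∷ y) = eqSub x y
eqSub (true ∷ x) (false ∷ y) = false
eqSub (false ∷ x) (true ∷ y) = false

-- Incidence number [ρ : σ] of the simplicial boundary with the
-- orientation induced by the order of Fin n:
-- if ρ = σ minus its vertex v, it is (-1)^(#vertices of σ below v),
-- and 0 otherwise.
inc : ∀ {n} → Subset n → Subset n → ℤ
inc [] [] = + 0
inc (false ∷ ρ) (false ∷ σ) = inc ρ σ
inc (true ∷ ρ) (true ∷ σ) = ℤ.- inc ρ σ
inc (false ∷ ρ) (true ∷ σ) with eqSub ρ σ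
... | true  = + 1
... | false = + 0
inc (true ∷ ρ) (false ∷ σ) = + 0

colComb : ∀ {n} → (Subset n → Subset n → ℤ) → List (Subset n) → (Subset n → ℤ) → Subset n → ℤ
colComb M L a ρ = Data.List.foldr ℤ._+_ (+ 0) (map (λ τ → M ρ τ ℤ.* a τ) L)

-- Rank of the integer matrix M with rows `rows` and columns `cols`:
-- maximal number of columns linearly independent over ℤ (= over ℚ).

IndepCols : ∀ {n} → List (Subset n) → (Subset n → Subset n → ℤ) → List (Subset n) → Set
IndepCols {n} rows M L =
  ∀ (a : Subset n → ℤ) → (∀ ρ → ρ ∈ rows → colComb M L a ρ ≡ + 0) →
  ∀ τ → τ ∈ L → a τ ≡ + 0

HasRank : ∀ {n} → List (Subset n) → List (Subset n) → (Subset n → Subset n → ℤ) → ℕ → Set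
HasRank {n} rows cols M r =
  (∃ λ (L : List (Subset n)) →
     All (_∈ cols) L × Unique L × IndepCols rows M L × length L ≡ r)
  × (∀ (L : List (Subset n)) → All (_∈ cols) L → Unique L → IndepCols rows M L → length L ≤ r)

-- Reduced Betti number: Betti K m b  means  β_m(K) = b, where
-- β_m = dim C_m - rank ∂_m - rank ∂_{m+1}
-- (∂_0 is the augmentation, coming from the empty face).
Betti : ∀ {n} → Cx n → ℕ → ℕ → Set
Betti K m b = ∃ λ r₁ → ∃ λ r₂ →
  HasRank (facesOfSize K m) (facesOfSize K (suc m)) inc r₁
  × HasRank (facesOfSize K (suc m)) (facesOfSize K (suc (suc m))) inc r₂
  × b + r₁ + r₂ ≡ length (facesOfSize K (suc m))

removeFacet : ∀ {n} → Cx n → Subset n → Cx n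
removeFacet K f σ = K σ ∧ not (eqSub σ f)

IsBridge : ∀ {n} → Cx n → ℕ → Subset n → Set
IsBridge K d f = f ∈ facesOfSize K (suc d) ×
  (∃ λ b → ∃ λ b' → Betti K (d ∸ 1) b × Betti (removeFacet K f) (d ∸ 1) b' × b' ≡ suc b)

Bridgeless : ∀ {n} → Cx n → ℕ → Set
Bridgeless {n} K d = ∀ (f : Subset n) → ¬ IsBridge K d f

NZFlow : ∀ {n} → Cx n → ℕ → ℕ → Set
NZFlow {n} K d q = Σ (Subset n → ℕ) λ φ →
  (∀ σ → σ ∈ facesOfSize K (suc d) → φ σ < q)
  × (∀ σ → σ ∈ facesOfSize K (suc d) → ¬ (φ σ ≡ 0))
  × (∀ ρ → ρ ∈ facesOfSize K d →
       (+ q) ∣ℤ colComb inc (facesOfSize K (suc d)) (λ σ → + (φ σ)) ρ)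

FlowBound : ℕ → ℕ → Set
FlowBound d B = ∀ (n : ℕ) (K : Cx n) → IsComplex K → HasDim K d → Bridgeless K d →
  ∃ λ q → 1 ≤ q × q ≤ B × NZFlow K d q

{-# OPTIONS --safe #-}
-- The suspension ΣK of a d-complex K (K together with the cones over it from two new apexes)
-- is a (d+1)-complex, and a nowhere-zero q-flow on ΣK restricts to one on K along the facets
-- apex₁ ∪ σ, because ∂(apex₁ ∪ σ) = σ − apex₁ ∪ ∂σ. It remains to see that ΣK is bridgeless.
-- Since Betti numbers are defined through ranks of boundary matrices, a facet is a bridge exactly
-- when it is a coloop of the columns of ∂, i.e. has coefficient zero in every integer relation
-- among them; and a relation z of K through g suspends to the relation apex₁ * z − apex₂ * z
-- of ΣK through both apex₁ ∪ g and apex₂ ∪ g. Ranks exist only classically, so the passage from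
-- a coloop of K back to a bridge is made under double negation, which suffices as the goal is ⊥.
module Submission where

open import Defs

open import Data.Bool using (true; false; _∧_; not; if_then_else_; T)
import Data.Bool as Bool
open import Data.Bool.Properties using (T-≡; T-∧)
open import Data.Empty using (⊥; ⊥-elim)
open import Data.Fin.Subset using (Subset; ∣_∣; _⊆_)
open import Data.Fin.Subset.Properties using (out⊆; s⊆s; ⊆-refl; drop-∷-⊆)
open import Data.Integer using (ℤ; +_; _+_; _*_; -_; _-_)
open import Data.Integer.Divisibility using () renaming (_∣_ to _∣ℤ_)
import Data.Integer.Properties as ℤ
open import Data.Integer.Tactic.RingSolver using (solve-∀)
open import Data.List using (List; []; _∷_; map; _++_; filter; length; foldr)
open import Data.List.Properties using (filter-all; filter-accept; filter-reject; filter-≐; length-++)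
open import Data.List.Membership.Propositional using (_∈_; _∉_; find)
open import Data.List.Membership.Propositional.Properties
  using (∈-filter⁺; ∈-filter⁻; ∈-++⁻; ∈-++⁺ˡ; ∈-++⁺ʳ; ∈-map⁺; ∈-map⁻)
open import Data.List.Relation.Binary.Disjoint.Propositional using (Disjoint)
open import Data.List.Relation.Unary.All as All using (All; []; _∷_)
import Data.List.Relation.Unary.All.Properties as All
open import Data.List.Relation.Unary.All.Properties using (All¬⇒¬Any; ¬All⇒Any¬)
open import Data.List.Relation.Unary.AllPairs using ([]; _∷_)
open import Data.List.Relation.Unary.Any using (here; there)
open import Data.List.Relation.Unary.Unique.Propositional using (Unique)
import Data.List.Relation.Unary.Unique.Propositional.Properties as Unique
open import Data.Nat as ℕ using (ℕ; zero; suc; _≤_; _<_; z≤n; s≤s; _≡ᵇ_; _∸_)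
open import Data.Nat.Divisibility using () renaming (_∣_ to _∣ℕ_)
import Data.Nat.Properties as ℕ
open import Data.Product using (∃; _×_; _,_; proj₁; proj₂)
open import Data.Sum using (_⊎_; inj₁; inj₂; [_,_])
open import Data.Vec using ([]; _∷_; here; there)
open import Data.Vec.Properties using (≡-dec; ∷-injectiveʳ)
open import Function using (_∘_; case_of_)
open import Function.Bundles using (Equivalence)
open import Relation.Binary.Definitions using (DecidableEquality)
open import Relation.Binary.PropositionalEquality
  using (_≡_; _≢_; refl; sym; trans; cong; cong₂; subst; subst₂; module ≡-Reasoning)
open import Relation.Nullary using (¬_; Dec; yes; no; does; ¬?)
open import Relation.Nullary.Decidable using (_×-dec_; ¬¬-excluded-middle; T?)
open import Relation.Nullary.Negation using (¬¬-map)
open import Relation.Unary using (Decidable)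

∑ : {A : Set} → List A → (A → ℤ) → ℤ
∑ L h = foldr _+_ (+ 0) (map h L)

module _ {A : Set} where

  ∑-++ : ∀ (X Y : List A) h → ∑ (X ++ Y) h ≡ ∑ X h + ∑ Y h
  ∑-++ []      Y h = sym (ℤ.+-identityˡ _)
  ∑-++ (x ∷ X) Y h = trans (cong (_+_ (h x)) (∑-++ X Y h)) (sym (ℤ.+-assoc (h x) _ _))

  ∑-cong : ∀ (L : List A) {h k} → (∀ x → x ∈ L → h x ≡ k x) → ∑ L h ≡ ∑ L k
  ∑-cong []      e = refl
  ∑-cong (x ∷ L) e = cong₂ _+_ (e x (here refl)) (∑-cong L (λ y y∈L → e y (there y∈L)))

  ∑-zero : ∀ (L : List A) {h} → (∀ x → x ∈ L → h x ≡ + 0) → ∑ L h ≡ + 0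
  ∑-zero L e = trans (∑-cong L e) (∑-const-zero L)
    where
      ∑-const-zero : ∀ (L : List A) → ∑ L (λ _ → + 0) ≡ + 0
      ∑-const-zero []      = refl
      ∑-const-zero (_ ∷ L) = trans (ℤ.+-identityˡ _) (∑-const-zero L)

  ∑-distrib-+ : ∀ (L : List A) h k → ∑ L (λ x → h x + k x) ≡ ∑ L h + ∑ L k
  ∑-distrib-+ []      h k = refl
  ∑-distrib-+ (x ∷ L) h k =
    trans (cong (_+_ (h x + k x)) (∑-distrib-+ L h k)) (interchange (h x) (k x) _ _)
    where
      interchange : ∀ a b c e → a + b + (c + e) ≡ a + c + (b + e)
      interchange = solve-∀

  ∑-*ˡ : ∀ (L : List A) c h → ∑ L (λ x → c * h x) ≡ c * ∑ L h
  ∑-*ˡ []      c h = sym (ℤ.*-zeroʳ c)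
  ∑-*ˡ (x ∷ L) c h = trans (cong (_+_ (c * h x)) (∑-*ˡ L c h)) (sym (ℤ.*-distribˡ-+ c (h x) _))

  ∑-neg : ∀ (L : List A) h → ∑ L (λ x → - h x) ≡ - ∑ L h
  ∑-neg []      h = refl
  ∑-neg (x ∷ L) h = trans (cong (_+_ (- h x)) (∑-neg L h)) (sym (ℤ.neg-distrib-+ (h x) _))

  ∑-filter : ∀ {P : A → Set} (P? : ∀ x → Dec (P x)) L h →
             ∑ (filter P? L) h ≡ ∑ L (λ x → if does (P? x) then h x else + 0)
  ∑-filter P? []      h = refl
  ∑-filter P? (x ∷ L) h with does (P? x)
  ... | true  = cong (_+_ (h x)) (∑-filter P? L h)
  ... | false = trans (∑-filter P? L h) (sym (ℤ.+-identityˡ _))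

module _ {A B : Set} where

  ∑-map : ∀ (g : A → B) (X : List A) h → ∑ (map g X) h ≡ ∑ X (λ x → h (g x))
  ∑-map g []      h = refl
  ∑-map g (x ∷ X) h = cong (_+_ (h (g x))) (∑-map g X h)

  ∑-comm : ∀ (X : List A) (Y : List B) (f : A → B → ℤ) →
           ∑ X (λ x → ∑ Y (f x)) ≡ ∑ Y (λ y → ∑ X (λ x → f x y))
  ∑-comm []      Y f = sym (∑-zero Y (λ _ _ → refl))
  ∑-comm (x ∷ X) Y f =
    trans (cong (_+_ (∑ Y (f x))) (∑-comm X Y f)) (sym (∑-distrib-+ Y (f x) _))

_≟ₛ_ : ∀ {n} → DecidableEquality (Subset n)
_≟ₛ_ = ≡-dec Bool._≟_

module _ {n : ℕ} where

  open import Data.List.Membership.DecPropositional (_≟ₛ_ {n}) public using (_∈?_)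

  infixl 6 _─_
  _─_ : List (Subset n) → Subset n → List (Subset n)
  L ─ c = filter (λ τ → ¬? (τ ≟ₛ c)) L

  ∈-─⁻ : ∀ {τ c} L → τ ∈ L ─ c → τ ∈ L × τ ≢ c
  ∈-─⁻ L = ∈-filter⁻ (λ τ → ¬? (τ ≟ₛ _))

  ∈-─⁺ : ∀ {τ c L} → τ ∈ L → τ ≢ c → τ ∈ L ─ c
  ∈-─⁺ = ∈-filter⁺ (λ τ → ¬? (τ ≟ₛ _))

  ─-∉ : ∀ {c L} → c ∉ L → L ─ c ≡ L
  ─-∉ {c} c∉L =
    filter-all (λ τ → ¬? (τ ≟ₛ c)) (All.tabulate λ τ∈L τ≡c → c∉L (subst (_∈ _) τ≡c τ∈L))

  ─-unique : ∀ {c L} → Unique L → Unique (L ─ c)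
  ─-unique = Unique.filter⁺ (λ τ → ¬? (τ ≟ₛ _))

  private
    ─-head : ∀ {x L} → All (x ≢_) L → (x ∷ L) ─ x ≡ L
    ─-head {x} x∉L =
      trans (filter-reject (λ τ → ¬? (τ ≟ₛ x)) (λ x≢x → x≢x refl)) (─-∉ (All¬⇒¬Any x∉L))

    head-∉ : ∀ {x c : Subset n} {L} → All (x ≢_) L → c ∈ L → x ≢ c
    head-∉ x∉L c∈L refl = All¬⇒¬Any x∉L c∈L

    ─-tail : ∀ {x c L} → x ≢ c → (x ∷ L) ─ c ≡ x ∷ (L ─ c)
    ─-tail {c = c} = filter-accept (λ τ → ¬? (τ ≟ₛ c))

  ∑-─ : ∀ {c} L h → Unique L → c ∈ L → ∑ L h ≡ h c + ∑ (L ─ c) h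
  ∑-─ (x ∷ L) h (x∉L ∷ _) (here refl) = cong (λ L′ → h x + ∑ L′ h) (sym (─-head x∉L))
  ∑-─ {c} (x ∷ L) h (x∉L ∷ uL) (there c∈L) = begin
    h x + ∑ L h                 ≡⟨ cong (_+_ (h x)) (∑-─ L h uL c∈L) ⟩
    h x + (h c + ∑ (L ─ c) h)   ≡⟨ swap (h x) (h c) _ ⟩
    h c + (h x + ∑ (L ─ c) h)   ≡⟨ cong (λ L′ → h c + ∑ L′ h) (sym (─-tail x≢c)) ⟩
    h c + ∑ ((x ∷ L) ─ c) h     ∎
    where
      open ≡-Reasoning
      swap : ∀ a b e → a + (b + e) ≡ b + (a + e)
      swap = solve-∀
      x≢c : x ≢ c
      x≢c = head-∉ x∉L c∈L

  ─-mono : ∀ {B C c} → All (_∈ C) B → All (_∈ C ─ c) (B ─ c)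
  ─-mono {B} B⊆C =
    All.tabulate λ τ∈ → ∈-─⁺ (All.lookup B⊆C (proj₁ (∈-─⁻ B τ∈))) (proj₂ (∈-─⁻ B τ∈))

  length-─ : ∀ {c} L → Unique L → c ∈ L → suc (length (L ─ c)) ≡ length L
  length-─ (x ∷ L) (x∉L ∷ _) (here refl) = cong (suc ∘ length) (─-head x∉L)
  length-─ (x ∷ L) (x∉L ∷ uL) (there c∈L) =
    trans (cong (suc ∘ length) (─-tail (head-∉ x∉L c∈L))) (cong suc (length-─ L uL c∈L))

  length≤suc-length-─ : ∀ {c} L → Unique L → length L ≤ suc (length (L ─ c))
  length≤suc-length-─ {c} L uL with c ∈? L
  ... | yes c∈L = ℕ.≤-reflexive (sym (length-─ L uL c∈L))
  ... | no  c∉L = ℕ.m≤n⇒m≤1+n (ℕ.≤-reflexive (cong length (sym (─-∉ c∉L))))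

  _[_≔_] : (Subset n → ℤ) → Subset n → ℤ → Subset n → ℤ
  (a [ c ≔ v ]) τ = if does (τ ≟ₛ c) then v else a τ

  [≔]-≡ : ∀ a c v → (a [ c ≔ v ]) c ≡ v
  [≔]-≡ a c v with c ≟ₛ c
  ... | yes _   = refl
  ... | no c≢c = ⊥-elim (c≢c refl)

  [≔]-≢ : ∀ a {c τ} v → τ ≢ c → (a [ c ≔ v ]) τ ≡ a τ
  [≔]-≢ a {c} {τ} v τ≢c with τ ≟ₛ c
  ... | yes τ≡c = ⊥-elim (τ≢c τ≡c)
  ... | no _    = refl

  unit : Subset n → Subset n → ℤ
  unit τ = (λ _ → + 0) [ τ ≔ + 1 ]

  ∑-unit : ∀ {τ} L (h : Subset n → ℤ) → Unique L → τ ∈ L → ∑ L (λ ρ → h ρ * unit τ ρ) ≡ h τ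
  ∑-unit {τ} L h uL τ∈L = begin
    ∑ L (λ ρ → h ρ * unit τ ρ)
      ≡⟨ ∑-─ L _ uL τ∈L ⟩
    h τ * unit τ τ + ∑ (L ─ τ) (λ ρ → h ρ * unit τ ρ)
      ≡⟨ cong₂ _+_ (cong (h τ *_) ([≔]-≡ (λ _ → + 0) τ (+ 1)))
           (∑-zero (L ─ τ) λ ρ ρ∈ → trans (cong (h ρ *_) ([≔]-≢ (λ _ → + 0) (+ 1) (proj₂ (∈-─⁻ L ρ∈))))
                                           (ℤ.*-zeroʳ (h ρ))) ⟩
    h τ * + 1 + + 0
      ≡⟨ trans (ℤ.+-identityʳ _) (ℤ.*-identityʳ (h τ)) ⟩
    h τ ∎
    where open ≡-Reasoning

*-≢0 : ∀ {i j : ℤ} → i ≢ + 0 → j ≢ + 0 → i * j ≢ + 0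
*-≢0 {i} i≢0 j≢0 ij≡0 = [ i≢0 , j≢0 ] (ℤ.i*j≡0⇒i≡0∨j≡0 i ij≡0)

≢0-*-≡0 : ∀ {i j : ℤ} → i ≢ + 0 → i * j ≡ + 0 → j ≡ + 0
≢0-*-≡0 {i} i≢0 ij≡0 =
  [ (λ i≡0 → ⊥-elim (i≢0 i≡0)) , (λ j≡0 → j≡0) ] (ℤ.i*j≡0⇒i≡0∨j≡0 i ij≡0)

module _ {n : ℕ} where

  IsRelation : List (Subset n) → (Subset n → Subset n → ℤ) → List (Subset n) → (Subset n → ℤ) → Set
  IsRelation rows M D a = ∀ ρ → ρ ∈ rows → colComb M D a ρ ≡ + 0

  colComb-*ˡ : ∀ M L k a (ρ : Subset n) → colComb M L (λ τ → k * a τ) ρ ≡ k * colComb M L a ρ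
  colComb-*ˡ M L k a ρ =
    trans (∑-cong L λ τ _ → x*[k*y]≡k*[x*y] (M ρ τ) k (a τ)) (∑-*ˡ L k λ τ → M ρ τ * a τ)
    where
      x*[k*y]≡k*[x*y] : ∀ x k y → x * (k * y) ≡ k * (x * y)
      x*[k*y]≡k*[x*y] = solve-∀

  colComb-update : ∀ M L a {c} v (ρ : Subset n) → Unique L → c ∈ L →
                   colComb M L (a [ c ≔ v ]) ρ ≡ M ρ c * v + colComb M (L ─ c) a ρ
  colComb-update M L a {c} v ρ uL c∈L =
    trans (∑-─ L (λ τ → M ρ τ * (a [ c ≔ v ]) τ) uL c∈L)
      (cong₂ _+_ (cong (M ρ c *_) ([≔]-≡ a c v))
                 (∑-cong (L ─ c) λ τ τ∈ → cong (M ρ τ *_) ([≔]-≢ a v (proj₂ (∈-─⁻ L τ∈)))))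

  colComb-─ : ∀ M L a c (ρ : Subset n) → colComb M (L ─ c) a ρ ≡ colComb M L (a [ c ≔ + 0 ]) ρ
  colComb-─ M L a c ρ = trans (∑-filter (λ τ → ¬? (τ ≟ₛ c)) L _) (∑-cong L pointwise)
    where
      pointwise : ∀ τ → τ ∈ L →
                  (if does (¬? (τ ≟ₛ c)) then M ρ τ * a τ else + 0) ≡ M ρ τ * (a [ c ≔ + 0 ]) τ
      pointwise τ _ with τ ≟ₛ c
      ... | yes _ = sym (ℤ.*-zeroʳ (M ρ τ))
      ... | no _  = refl

  -- Gaussian elimination of row ρ₀ with the pivot entry M ρ₀ τ₀, avoiding division.
  eliminate : (Subset n → Subset n → ℤ) → Subset n → Subset n → Subset n → Subset n → ℤ
  eliminate M ρ₀ τ₀ ρ τ = M ρ₀ τ₀ * M ρ τ - M ρ₀ τ * M ρ τ₀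

  colComb-eliminate : ∀ M ρ₀ τ₀ L a (ρ : Subset n) → Unique L → τ₀ ∈ L →
    colComb M L ((λ τ → M ρ₀ τ₀ * a τ) [ τ₀ ≔ - colComb M (L ─ τ₀) a ρ₀ ]) ρ
      ≡ colComb (eliminate M ρ₀ τ₀) (L ─ τ₀) a ρ
  colComb-eliminate M ρ₀ τ₀ L a ρ uL τ₀∈L = begin
    colComb M L ((λ τ → p * a τ) [ τ₀ ≔ - S₀ ]) ρ
      ≡⟨ colComb-update M L _ (- S₀) ρ uL τ₀∈L ⟩
    M ρ τ₀ * - S₀ + colComb M L′ (λ τ → p * a τ) ρ
      ≡⟨ cong (_+_ (M ρ τ₀ * - S₀)) (colComb-*ˡ M L′ p a ρ) ⟩
    M ρ τ₀ * - S₀ + p * colComb M L′ a ρ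
      ≡⟨ rearrange (M ρ τ₀) S₀ p _ ⟩
    p * colComb M L′ a ρ + - M ρ τ₀ * S₀
      ≡⟨ sym (cong₂ _+_ (∑-*ˡ L′ p _) (∑-*ˡ L′ (- M ρ τ₀) _)) ⟩
    ∑ L′ (λ τ → p * (M ρ τ * a τ)) + ∑ L′ (λ τ → - M ρ τ₀ * (M ρ₀ τ * a τ))
      ≡⟨ sym (∑-distrib-+ L′ _ _) ⟩
    ∑ L′ (λ τ → p * (M ρ τ * a τ) + - M ρ τ₀ * (M ρ₀ τ * a τ))
      ≡⟨ ∑-cong L′ (λ τ _ → expand p (M ρ τ) (M ρ₀ τ) (M ρ τ₀) (a τ)) ⟩
    colComb (eliminate M ρ₀ τ₀) L′ a ρ ∎
    where
      open ≡-Reasoning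
      p : ℤ
      p = M ρ₀ τ₀
      L′ : List (Subset n)
      L′ = L ─ τ₀
      S₀ : ℤ
      S₀ = colComb M L′ a ρ₀
      rearrange : ∀ m s p t → m * - s + p * t ≡ p * t + - m * s
      rearrange = solve-∀
      expand : ∀ p m m₀ m′ x → p * (m * x) + - m′ * (m₀ * x) ≡ (p * m - m₀ * m′) * x
      expand = solve-∀

  indep-eliminate : ∀ {rows M ρ₀ τ₀ L} → Unique L → τ₀ ∈ L → M ρ₀ τ₀ ≢ + 0 →
                    IndepCols (ρ₀ ∷ rows) M L → IndepCols rows (eliminate M ρ₀ τ₀) (L ─ τ₀)
  indep-eliminate {rows} {M} {ρ₀} {τ₀} {L} uL τ₀∈L pivot≢0 indep a rel τ τ∈L′ =
    ≢0-*-≡0 pivot≢0 (trans (sym ([≔]-≢ (λ τ → M ρ₀ τ₀ * a τ) _ (proj₂ (∈-─⁻ L τ∈L′))))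
                           (indep lift liftRel τ (proj₁ (∈-─⁻ L τ∈L′))))
    where
      lift : Subset n → ℤ
      lift = (λ τ → M ρ₀ τ₀ * a τ) [ τ₀ ≔ - colComb M (L ─ τ₀) a ρ₀ ]
      rowVanishes : ∀ p m x → (p * m - m * p) * x ≡ + 0
      rowVanishes = solve-∀
      liftRel : IsRelation (ρ₀ ∷ rows) M L lift
      liftRel ρ (here refl) = trans (colComb-eliminate M ρ₀ τ₀ L a ρ₀ uL τ₀∈L)
                                    (∑-zero (L ─ τ₀) λ τ _ → rowVanishes (M ρ₀ τ₀) (M ρ₀ τ) (a τ))
      liftRel ρ (there ρ∈) = trans (colComb-eliminate M ρ₀ τ₀ L a ρ uL τ₀∈L) (rel ρ ρ∈)

  indep⇒length≤rows : ∀ rows M L → Unique L → IndepCols rows M L → length L ≤ length rows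
  indep⇒length≤rows []          M []      _  _     = z≤n
  indep⇒length≤rows []          M (τ ∷ _) _  indep with () ← indep (λ _ → + 1) (λ _ ()) τ (here refl)
  indep⇒length≤rows (ρ₀ ∷ rows) M L       uL indep with All.all? (λ τ → M ρ₀ τ ℤ.≟ + 0) L
  ... | yes rowZero = ℕ.m≤n⇒m≤1+n (indep⇒length≤rows rows M L uL indepBelow)
    where
      indepBelow : IndepCols rows M L
      indepBelow a rel = indep a λ
        { ρ (here refl) → ∑-zero L λ τ τ∈L →
            trans (cong (_* a τ) (All.lookup rowZero τ∈L)) (ℤ.*-zeroˡ (a τ))
        ; ρ (there ρ∈) → rel ρ ρ∈ }
  ... | no rowNonzero with (τ₀ , τ₀∈L , pivot≢0) ← find (¬All⇒Any¬ (λ τ → M ρ₀ τ ℤ.≟ + 0) L rowNonzero) =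
    subst (_≤ suc (length rows)) (length-─ L uL τ₀∈L)
      (s≤s (indep⇒length≤rows rows (eliminate M ρ₀ τ₀) (L ─ τ₀) (─-unique uL)
              (indep-eliminate {rows} {M} uL τ₀∈L pivot≢0 indep)))

¬¬-All : ∀ {A : Set} {P : A → Set} (L : List A) →
         (∀ x → x ∈ L → ¬ ¬ P x) → ¬ ¬ (∀ x → x ∈ L → P x)
¬¬-All []      _   ¬all = ¬all λ _ ()
¬¬-All (x ∷ L) ¬¬P ¬all = ¬¬P x (here refl) λ Px →
  ¬¬-All L (λ y y∈L → ¬¬P y (there y∈L)) λ allL →
    ¬all λ { y (here refl) → Px ; y (there y∈L) → allL y y∈L }

¬¬-greatest : (P : ℕ → Set) → P 0 → ∀ N → (∀ k → P k → k ≤ N) →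
              ¬ ¬ (∃ λ r → P r × ∀ k → P k → k ≤ r)
¬¬-greatest P P0 N bounded ¬greatest =
  below (suc N) λ (r , Pr , maximal) →
    ¬greatest (r , Pr , λ k Pk → maximal k Pk (s≤s (bounded k Pk)))
  where
    below : ∀ j → ¬ ¬ (∃ λ r → P r × ∀ k → P k → k < j → k ≤ r)
    below zero    ¬below = ¬below (0 , P0 , λ _ _ ())
    below (suc j) ¬below = below j λ (r , Pr , maximal) → ¬¬-excluded-middle λ
      { (yes Pj) → ¬below (j , Pj , λ _ _ k<1+j → ℕ.≤-pred k<1+j)
      ; (no ¬Pj) → ¬below (r , Pr , λ k Pk k<1+j →
          [ maximal k Pk , (λ { refl → ⊥-elim (¬Pj Pk) }) ] (ℕ.m≤n⇒m<n∨m≡n (ℕ.≤-pred k<1+j))) }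

module Columns {n : ℕ} (rows : List (Subset n)) (M : Subset n → Subset n → ℤ) where

  column : Subset n → Subset n → ℤ
  column τ ρ = M ρ τ

  -- v lies in the rational span of the columns V, with the denominator k cleared.
  InSpan : List (Subset n) → (Subset n → ℤ) → Set
  InSpan V v = ∃ λ k → k ≢ + 0 × ∃ λ β → ∀ ρ → ρ ∈ rows → k * v ρ ≡ colComb M V β ρ

  IsColoop : List (Subset n) → Subset n → Set
  IsColoop C c = ∀ D a → Unique D → All (_∈ C) D → IsRelation rows M D a → c ∈ D → a c ≡ + 0

  relation-∷ : ∀ {c L b} → b c ≡ + 0 → IsRelation rows M (c ∷ L) b → IsRelation rows M L b
  relation-∷ {c} {L} {b} bc≡0 rel ρ ρ∈ = begin
    colComb M L b ρ                    ≡⟨ sym (ℤ.+-identityˡ _) ⟩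
    + 0 + colComb M L b ρ              ≡⟨ cong (_+ colComb M L b ρ) (sym Mc*bc≡0) ⟩
    M ρ c * b c + colComb M L b ρ      ≡⟨ rel ρ ρ∈ ⟩
    + 0                                ∎
    where
      open ≡-Reasoning
      Mc*bc≡0 : M ρ c * b c ≡ + 0
      Mc*bc≡0 = trans (cong (M ρ c *_) bc≡0) (ℤ.*-zeroʳ (M ρ c))

  indep-─ : ∀ {L c} → IndepCols rows M L → IndepCols rows M (L ─ c)
  indep-─ {L} {c} indep a rel τ τ∈ =
    trans (sym ([≔]-≢ a (+ 0) (proj₂ (∈-─⁻ L τ∈))))
          (indep (a [ c ≔ + 0 ]) (λ ρ ρ∈ → trans (sym (colComb-─ M L a c ρ)) (rel ρ ρ∈))
                 τ (proj₁ (∈-─⁻ L τ∈)))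

  column-inSpan : ∀ {V t} → Unique V → t ∈ V → InSpan V (column t)
  column-inSpan {V} {t} uV t∈V =
    + 1 , (λ ()) , unit t , λ ρ _ →
      trans (ℤ.*-identityˡ (M ρ t)) (sym (∑-unit V (M ρ) uV t∈V))

  inSpan-colComb : ∀ {V} T a → (∀ t → t ∈ T → InSpan V (column t)) → InSpan V (colComb M T a)
  inSpan-colComb {V} [] a _ =
    + 1 , (λ ()) , (λ _ → + 0) , λ ρ _ → sym (∑-zero V λ τ _ → ℤ.*-zeroʳ (M ρ τ))
  inSpan-colComb {V} (t ∷ T) a spans
    with (k₁ , k₁≢0 , β₁ , eq₁) ← inSpan-colComb {V} T a (λ t′ t′∈T → spans t′ (there t′∈T))
       | (k₂ , k₂≢0 , β₂ , eq₂) ← spans t (here refl) =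
    k₁ * k₂ , *-≢0 k₁≢0 k₂≢0 , (λ τ → k₁ * a t * β₂ τ + k₂ * β₁ τ) , λ ρ ρ∈ → begin
      k₁ * k₂ * (M ρ t * a t + colComb M T a ρ)
        ≡⟨ regroup k₁ k₂ (a t) (M ρ t) _ ⟩
      k₁ * a t * (k₂ * M ρ t) + k₂ * (k₁ * colComb M T a ρ)
        ≡⟨ cong₂ _+_ (cong (k₁ * a t *_) (eq₂ ρ ρ∈)) (cong (k₂ *_) (eq₁ ρ ρ∈)) ⟩
      k₁ * a t * colComb M V β₂ ρ + k₂ * colComb M V β₁ ρ
        ≡⟨ sym (cong₂ _+_ (colComb-*ˡ M V (k₁ * a t) β₂ ρ) (colComb-*ˡ M V k₂ β₁ ρ)) ⟩
      colComb M V (λ τ → k₁ * a t * β₂ τ) ρ + colComb M V (λ τ → k₂ * β₁ τ) ρ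
        ≡⟨ sym (∑-distrib-+ V _ _) ⟩
      ∑ V (λ τ → M ρ τ * (k₁ * a t * β₂ τ) + M ρ τ * (k₂ * β₁ τ))
        ≡⟨ ∑-cong V (λ τ _ → sym (ℤ.*-distribˡ-+ (M ρ τ) _ _)) ⟩
      colComb M V (λ τ → k₁ * a t * β₂ τ + k₂ * β₁ τ) ρ ∎
    where
      open ≡-Reasoning
      regroup : ∀ k₁ k₂ x m s → k₁ * k₂ * (m * x + s) ≡ k₁ * x * (k₂ * m) + k₂ * (k₁ * s)
      regroup = solve-∀

  ¬inSpan⇒indep-∷ : ∀ {V t} → IndepCols rows M V → ¬ InSpan V (column t) → IndepCols rows M (t ∷ V)
  ¬inSpan⇒indep-∷ {V} {t} indepV ¬span b rel = λ
    { τ (here refl) → bt≡0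
    ; τ (there τ∈V) → indepV b (relation-∷ {L = V} bt≡0 rel) τ τ∈V }
    where
      bt≡0 : b t ≡ + 0
      bt≡0 with b t ℤ.≟ + 0
      ... | yes bt≡0 = bt≡0
      ... | no bt≢0 = ⊥-elim (¬span (b t , bt≢0 , (λ τ → - b τ) , λ ρ ρ∈ → begin
        b t * M ρ t                         ≡⟨ solveFor (M ρ t) (b t) _ ⟩
        (M ρ t * b t + colComb M V b ρ) - colComb M V b ρ
                                            ≡⟨ cong (_- colComb M V b ρ) (rel ρ ρ∈) ⟩
        + 0 - colComb M V b ρ               ≡⟨ ℤ.+-identityˡ _ ⟩
        - colComb M V b ρ                   ≡⟨ sym (∑-neg V _) ⟩
        ∑ V (λ τ → - (M ρ τ * b τ))         ≡⟨ ∑-cong V (λ τ _ → ℤ.neg-distribʳ-* (M ρ τ) (b τ)) ⟩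
        colComb M V (λ τ → - b τ) ρ         ∎))
        where
          open ≡-Reasoning
          solveFor : ∀ m x s → x * m ≡ (m * x + s) - s
          solveFor = solve-∀

  inSpan-─⇒¬indep : ∀ {B c} → Unique B → c ∈ B → InSpan (B ─ c) (column c) → ¬ IndepCols rows M B
  inSpan-─⇒¬indep {B} {c} uB c∈B (k , k≢0 , β , eq) indepB =
    k≢0 (trans (sym (ℤ.neg-involutive k))
               (cong -_ (trans (sym ([≔]-≡ β c (- k))) (indepB α rel c c∈B))))
    where
      α : Subset n → ℤ
      α = β [ c ≔ - k ]
      cancel : ∀ m k → m * - k + k * m ≡ + 0
      cancel = solve-∀
      rel : IsRelation rows M B α
      rel ρ ρ∈ = begin
        colComb M B α ρ                          ≡⟨ colComb-update M B β (- k) ρ uB c∈B ⟩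
        M ρ c * - k + colComb M (B ─ c) β ρ      ≡⟨ cong (_+_ (M ρ c * - k)) (sym (eq ρ ρ∈)) ⟩
        M ρ c * - k + k * M ρ c                  ≡⟨ cancel (M ρ c) k ⟩
        + 0                                      ∎
        where open ≡-Reasoning

  relation⇒inSpan-column : ∀ {D a c V} → Unique D → c ∈ D → a c ≢ + 0 → IsRelation rows M D a →
                           InSpan V (colComb M (D ─ c) a) → InSpan V (column c)
  relation⇒inSpan-column {D} {a} {c} {V} uD c∈D ac≢0 rel (k , k≢0 , β , eq) =
    k * - a c , *-≢0 k≢0 (λ -ac≡0 → ac≢0 (trans (sym (ℤ.neg-involutive (a c))) (cong -_ -ac≡0))) ,
    β , λ ρ ρ∈ → begin
      k * - a c * M ρ c                                  ≡⟨ isolate k (a c) (M ρ c) (colComb M (D ─ c) a ρ) ⟩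
      k * (colComb M (D ─ c) a ρ - (M ρ c * a c + colComb M (D ─ c) a ρ))
        ≡⟨ cong (λ z → k * (colComb M (D ─ c) a ρ - z))
                (trans (sym (∑-─ D (λ τ → M ρ τ * a τ) uD c∈D)) (rel ρ ρ∈)) ⟩
      k * (colComb M (D ─ c) a ρ + + 0)                  ≡⟨ cong (k *_) (ℤ.+-identityʳ _) ⟩
      k * colComb M (D ─ c) a ρ                          ≡⟨ eq ρ ρ∈ ⟩
      colComb M V β ρ                                    ∎
    where
      open ≡-Reasoning
      isolate : ∀ k x m s → k * - x * m ≡ k * (s - (m * x + s))
      isolate = solve-∀

  -- Exchange argument: were c on a relation D, every other column of D would lie in the span of
  -- B ─ c, since otherwise it would extend B ─ c to an independent family of size r avoiding c;
  -- then c itself would lie in that span, contradicting the independence of B.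
  rank-suc⇒coloop : ∀ {C c r r′} → HasRank rows C M r → HasRank rows (C ─ c) M r′ → r ≡ suc r′ →
                    IsColoop C c
  rank-suc⇒coloop {C} {c} {r′ = r′} ((B , B⊆C , uB , indepB , refl) , _) (_ , maximal′) r≡1+r′
                  D a uD D⊆C rel c∈D with a c ℤ.≟ + 0
  ... | yes ac≡0 = ac≡0
  ... | no ac≢0 = ⊥-elim (exchange (c ∈? B))
    where
      noIndepOfRank : ∀ L → All (_∈ C ─ c) L → Unique L → IndepCols rows M L → length L ≡ length B → ⊥
      noIndepOfRank L L⊆ uL indepL lenL =
        ℕ.1+n≰n (subst (_≤ r′) (trans lenL r≡1+r′) (maximal′ L L⊆ uL indepL))

      exchange : Dec (c ∈ B) → ⊥
      exchange (no c∉B) =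
        noIndepOfRank B (All.tabulate λ τ∈B → ∈-─⁺ (All.lookup B⊆C τ∈B) λ { refl → c∉B τ∈B })
                      uB indepB refl
      exchange (yes c∈B) = ¬¬-All (D ─ c) spans λ allSpan →
        inSpan-─⇒¬indep uB c∈B
          (relation⇒inSpan-column {V = B ─ c} uD c∈D ac≢0 rel (inSpan-colComb {B ─ c} (D ─ c) a allSpan))
          indepB
        where
          spans : ∀ t → t ∈ D ─ c → ¬ ¬ InSpan (B ─ c) (column t)
          spans t t∈ ¬span =
            noIndepOfRank (t ∷ B ─ c)
              (All.lookup (─-mono D⊆C) t∈ ∷ ─-mono B⊆C)
              (All.tabulate (λ { τ∈ refl → ¬span (column-inSpan (─-unique uB) τ∈) }) ∷ ─-unique uB)
              (¬inSpan⇒indep-∷ (indep-─ indepB) ¬span)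
              (length-─ B uB c∈B)

  rank-exists : ∀ C → ¬ ¬ ∃ (HasRank rows C M)
  rank-exists C = ¬¬-map toRank (¬¬-greatest IndepOfSize empty (length rows) bounded)
    where
      IndepOfSize : ℕ → Set
      IndepOfSize k = ∃ λ L → All (_∈ C) L × Unique L × IndepCols rows M L × length L ≡ k
      empty : IndepOfSize 0
      empty = [] , [] , [] , (λ _ _ _ ()) , refl
      bounded : ∀ k → IndepOfSize k → k ≤ length rows
      bounded _ (L , _ , uL , indepL , refl) = indep⇒length≤rows rows M L uL indepL
      toRank : (∃ λ r → IndepOfSize r × ∀ k → IndepOfSize k → k ≤ r) → ∃ (HasRank rows C M)
      toRank (r , indepOfRank , maximal) =
        r , indepOfRank , λ L L⊆C uL indepL → maximal (length L) (L , L⊆C , uL , indepL , refl)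

  rank-unique : ∀ {C r r′} → HasRank rows C M r → HasRank rows C M r′ → r ≡ r′
  rank-unique ((L , L⊆C , uL , indepL , refl) , maximal) ((L′ , L′⊆C , uL′ , indepL′ , refl) , maximal′) =
    ℕ.≤-antisym (maximal′ L L⊆C uL indepL) (maximal L′ L′⊆C uL′ indepL′)

  coloop-∷-indep : ∀ {C c L} → IsColoop C c → c ∈ C → All (_∈ C) L → Unique (c ∷ L) →
                   IndepCols rows M L → IndepCols rows M (c ∷ L)
  coloop-∷-indep {C} {c} {L} coloop c∈C L⊆C ucL indepL b rel = λ
    { τ (here refl) → bc≡0
    ; τ (there τ∈L) → indepL b (relation-∷ {L = L} bc≡0 rel) τ τ∈L }
    where
      bc≡0 : b c ≡ + 0
      bc≡0 = coloop (c ∷ L) b ucL (c∈C ∷ L⊆C) rel (here refl)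

  coloop⇒rank-suc : ∀ {C c r r′} → c ∈ C → IsColoop C c →
                    HasRank rows C M r → HasRank rows (C ─ c) M r′ → r ≡ suc r′
  coloop⇒rank-suc {C} {c} c∈C coloop ((B , B⊆C , uB , indepB , refl) , maximal)
                                      ((L , L⊆C─c , uL , indepL , refl) , maximal′) =
    ℕ.≤-antisym (ℕ.≤-trans (length≤suc-length-─ B uB) (s≤s lenB─c≤))
                (maximal (c ∷ L) (c∈C ∷ L⊆C) ucL (coloop-∷-indep coloop c∈C L⊆C ucL indepL))
    where
      L⊆C : All (_∈ C) L
      L⊆C = All.map (λ τ∈ → proj₁ (∈-─⁻ C τ∈)) L⊆C─c
      ucL : Unique (c ∷ L)
      ucL = All.map (λ τ∈ c≡τ → proj₂ (∈-─⁻ C τ∈) (sym c≡τ)) L⊆C─c ∷ uL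
      lenB─c≤ : length (B ─ c) ≤ length L
      lenB─c≤ = maximal′ (B ─ c) (─-mono B⊆C) (─-unique uB) (indep-─ indepB)

module _ {n : ℕ} where

  ∑-*-colComb : ∀ (X Y : List (Subset n)) (g : Subset n → ℤ) F a →
    ∑ X (λ ρ → g ρ * colComb F Y a ρ) ≡ ∑ Y (λ τ → a τ * ∑ X (λ ρ → g ρ * F ρ τ))
  ∑-*-colComb X Y g F a = begin
    ∑ X (λ ρ → g ρ * colComb F Y a ρ)
      ≡⟨ ∑-cong X (λ ρ _ → sym (trans (∑-cong Y λ τ _ → reassoc (g ρ) (F ρ τ) (a τ))
                                      (∑-*ˡ Y (g ρ) λ τ → F ρ τ * a τ))) ⟩
    ∑ X (λ ρ → ∑ Y (λ τ → a τ * (g ρ * F ρ τ)))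
      ≡⟨ ∑-comm X Y (λ ρ τ → a τ * (g ρ * F ρ τ)) ⟩
    ∑ Y (λ τ → ∑ X (λ ρ → a τ * (g ρ * F ρ τ)))
      ≡⟨ ∑-cong Y (λ τ _ → ∑-*ˡ X (a τ) λ ρ → g ρ * F ρ τ) ⟩
    ∑ Y (λ τ → a τ * ∑ X (λ ρ → g ρ * F ρ τ)) ∎
    where
      open ≡-Reasoning
      reassoc : ∀ g f x → x * (g * f) ≡ g * (f * x)
      reassoc = solve-∀

  unitsThen : List (Subset n) → (Subset n → Subset n → ℤ) → Subset n → Subset n → ℤ
  unitsThen L₁ N ρ τ = if does (τ ∈? L₁) then unit τ ρ else N ρ τ

  colComb-unitsThen : ∀ {L₁ L₂} N a ρ → Disjoint L₁ L₂ →
    colComb (unitsThen L₁ N) (L₁ ++ L₂) a ρ ≡ ∑ L₁ (λ τ → unit τ ρ * a τ) + colComb N L₂ a ρ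
  colComb-unitsThen {L₁} {L₂} N a ρ disjoint =
    trans (∑-++ L₁ L₂ _) (cong₂ _+_ (∑-cong L₁ onL₁) (∑-cong L₂ onL₂))
    where
      onL₁ : ∀ τ → τ ∈ L₁ → unitsThen L₁ N ρ τ * a τ ≡ unit τ ρ * a τ
      onL₁ τ τ∈L₁ with τ ∈? L₁
      ... | yes _    = refl
      ... | no τ∉L₁ = ⊥-elim (τ∉L₁ τ∈L₁)
      onL₂ : ∀ τ → τ ∈ L₂ → unitsThen L₁ N ρ τ * a τ ≡ N ρ τ * a τ
      onL₂ τ τ∈L₂ with τ ∈? L₁
      ... | yes τ∈L₁ = ⊥-elim (disjoint (τ∈L₁ , τ∈L₂))
      ... | no _     = refl

  colComb-as-∑-units : ∀ {R L₁} M a ρ₀ → Unique R → All (_∈ R) L₁ →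
    colComb M L₁ a ρ₀ ≡ ∑ R (λ ρ → M ρ₀ ρ * ∑ L₁ (λ τ → unit τ ρ * a τ))
  colComb-as-∑-units {R} {L₁} M a ρ₀ uR L₁⊆R = begin
    colComb M L₁ a ρ₀
      ≡⟨ ∑-cong L₁ (λ τ τ∈ → trans (ℤ.*-comm (M ρ₀ τ) (a τ))
                             (cong (a τ *_) (sym (∑-unit R (M ρ₀) uR (All.lookup L₁⊆R τ∈))))) ⟩
    ∑ L₁ (λ τ → a τ * ∑ R (λ ρ → M ρ₀ ρ * unit τ ρ))
      ≡⟨ sym (∑-*-colComb R L₁ (M ρ₀) (λ ρ τ → unit τ ρ) a) ⟩
    ∑ R (λ ρ → M ρ₀ ρ * ∑ L₁ (λ τ → unit τ ρ * a τ)) ∎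
    where open ≡-Reasoning

  -- Since M N = 0, applying M to a relation among the columns unit τ (τ ∈ L₁) and the columns of N
  -- indexed by L₂ yields a relation among the columns of M indexed by L₁.
  indep-unitsThen : ∀ {R₀ R L₁ L₂ : List (Subset n)} {M N} →
    Unique R → All (_∈ R) L₁ → Disjoint L₁ L₂ →
    (∀ ρ₀ → ρ₀ ∈ R₀ → ∀ τ → τ ∈ L₂ → ∑ R (λ ρ → M ρ₀ ρ * N ρ τ) ≡ + 0) →
    IndepCols R₀ M L₁ → IndepCols R N L₂ → IndepCols R (unitsThen L₁ N) (L₁ ++ L₂)
  indep-unitsThen {R₀} {R} {L₁} {L₂} {M} {N} uR L₁⊆R disjoint MN≡0 indepL₁ indepL₂ a rel τ τ∈ =
    [ a≡0-on-L₁ τ , indepL₂ a relN τ ] (∈-++⁻ L₁ τ∈)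
    where
      A₁ A₂ : Subset n → ℤ
      A₁ ρ = ∑ L₁ (λ τ → unit τ ρ * a τ)
      A₂ = colComb N L₂ a

      rel₁₂ : ∀ ρ → ρ ∈ R → A₁ ρ + A₂ ρ ≡ + 0
      rel₁₂ ρ ρ∈ = trans (sym (colComb-unitsThen N a ρ disjoint)) (rel ρ ρ∈)

      MA₂≡0 : ∀ ρ₀ → ρ₀ ∈ R₀ → ∑ R (λ ρ → M ρ₀ ρ * A₂ ρ) ≡ + 0
      MA₂≡0 ρ₀ ρ₀∈ = trans (∑-*-colComb R L₂ (M ρ₀) N a)
        (∑-zero L₂ λ τ τ∈ → trans (cong (a τ *_) (MN≡0 ρ₀ ρ₀∈ τ τ∈)) (ℤ.*-zeroʳ (a τ)))

      M[A₁+A₂]≡0 : ∀ ρ₀ → ∑ R (λ ρ → M ρ₀ ρ * A₁ ρ + M ρ₀ ρ * A₂ ρ) ≡ + 0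
      M[A₁+A₂]≡0 ρ₀ = ∑-zero R λ ρ ρ∈ → trans (sym (ℤ.*-distribˡ-+ (M ρ₀ ρ) _ _))
                                             (trans (cong (M ρ₀ ρ *_) (rel₁₂ ρ ρ∈)) (ℤ.*-zeroʳ (M ρ₀ ρ)))

      relM : IsRelation R₀ M L₁ a
      relM ρ₀ ρ₀∈ = begin
        colComb M L₁ a ρ₀                                           ≡⟨ colComb-as-∑-units M a ρ₀ uR L₁⊆R ⟩
        ∑ R (λ ρ → M ρ₀ ρ * A₁ ρ)                                   ≡⟨ sym (ℤ.+-identityʳ _) ⟩
        ∑ R (λ ρ → M ρ₀ ρ * A₁ ρ) + + 0
          ≡⟨ cong (_+_ (∑ R (λ ρ → M ρ₀ ρ * A₁ ρ))) (sym (MA₂≡0 ρ₀ ρ₀∈)) ⟩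
        ∑ R (λ ρ → M ρ₀ ρ * A₁ ρ) + ∑ R (λ ρ → M ρ₀ ρ * A₂ ρ)       ≡⟨ sym (∑-distrib-+ R _ _) ⟩
        ∑ R (λ ρ → M ρ₀ ρ * A₁ ρ + M ρ₀ ρ * A₂ ρ)                   ≡⟨ M[A₁+A₂]≡0 ρ₀ ⟩
        + 0                                                          ∎
        where open ≡-Reasoning

      a≡0-on-L₁ : ∀ τ → τ ∈ L₁ → a τ ≡ + 0
      a≡0-on-L₁ = indepL₁ a relM

      relN : IsRelation R N L₂ a
      relN ρ ρ∈ = trans (sym (trans (cong (_+ A₂ ρ) A₁≡0) (ℤ.+-identityˡ _))) (rel₁₂ ρ ρ∈)
        where
          A₁≡0 : A₁ ρ ≡ + 0
          A₁≡0 = ∑-zero L₁ λ τ τ∈ → trans (cong (unit τ ρ *_) (a≡0-on-L₁ τ τ∈)) (ℤ.*-zeroʳ (unit τ ρ))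

  MN≡0⇒length-+≤ : ∀ {R₀ R L₁ L₂ : List (Subset n)} {M N} →
    Unique R → All (_∈ R) L₁ → Disjoint L₁ L₂ →
    (∀ ρ₀ → ρ₀ ∈ R₀ → ∀ τ → τ ∈ L₂ → ∑ R (λ ρ → M ρ₀ ρ * N ρ τ) ≡ + 0) →
    Unique L₁ → IndepCols R₀ M L₁ → Unique L₂ → IndepCols R N L₂ →
    length L₁ ℕ.+ length L₂ ≤ length R
  MN≡0⇒length-+≤ {R₀} {R} {L₁} {L₂} {M} {N} uR L₁⊆R disjoint MN≡0 uL₁ indepL₁ uL₂ indepL₂ =
    subst (_≤ length R) (length-++ L₁)
      (indep⇒length≤rows R (unitsThen L₁ N) (L₁ ++ L₂) (Unique.++⁺ uL₁ uL₂ disjoint)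
        (indep-unitsThen {R₀} {M = M} uR L₁⊆R disjoint MN≡0 indepL₁ indepL₂))

allSubsets-complete : ∀ {n} (σ : Subset n) → σ ∈ allSubsets n
allSubsets-complete []              = here refl
allSubsets-complete {suc n} (false ∷ σ) = ∈-++⁺ˡ (∈-map⁺ (false ∷_) (allSubsets-complete σ))
allSubsets-complete {suc n} (true ∷ σ)  =
  ∈-++⁺ʳ (map (false ∷_) (allSubsets n)) (∈-map⁺ (true ∷_) (allSubsets-complete σ))

allSubsets-unique : ∀ n → Unique (allSubsets n)
allSubsets-unique zero    = [] ∷ []
allSubsets-unique (suc n) =
  Unique.++⁺ (Unique.map⁺ ∷-injectiveʳ (allSubsets-unique n))
             (Unique.map⁺ ∷-injectiveʳ (allSubsets-unique n))
             λ (σ∈false , σ∈true) → headsDiffer (∈-map⁻ (false ∷_) σ∈false) (∈-map⁻ (true ∷_) σ∈true)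
  where
    headsDiffer : ∀ {σ : Subset (suc n)} → ∃ (λ τ → τ ∈ allSubsets n × σ ≡ false ∷ τ) →
                  ∃ (λ τ → τ ∈ allSubsets n × σ ≡ true ∷ τ) → ⊥
    headsDiffer (_ , _ , refl) (_ , _ , ())

∑-allSubsets-suc : ∀ n (h : Subset (suc n) → ℤ) →
  ∑ (allSubsets (suc n)) h ≡ ∑ (allSubsets n) (λ σ → h (false ∷ σ)) + ∑ (allSubsets n) (λ σ → h (true ∷ σ))
∑-allSubsets-suc n h =
  trans (∑-++ (map (false ∷_) (allSubsets n)) _ h)
        (cong₂ _+_ (∑-map (false ∷_) (allSubsets n) h) (∑-map (true ∷_) (allSubsets n) h))

module _ {n : ℕ} (K : Cx n) where

  isFace⁺ : ∀ {s σ} → K σ ≡ true → ∣ σ ∣ ≡ s → T (K σ ∧ (∣ σ ∣ ≡ᵇ s))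
  isFace⁺ {s} {σ} Kσ size = Equivalence.from T-∧ (Equivalence.from T-≡ Kσ , ℕ.≡⇒≡ᵇ ∣ σ ∣ s size)

  ∈-facesOfSize⁺ : ∀ {s σ} → K σ ≡ true → ∣ σ ∣ ≡ s → σ ∈ facesOfSize K s
  ∈-facesOfSize⁺ {s} {σ} Kσ size =
    ∈-filter⁺ (λ τ → T? (K τ ∧ (∣ τ ∣ ≡ᵇ s))) (allSubsets-complete σ) (isFace⁺ Kσ size)

  ∈-facesOfSize⁻ : ∀ {s σ} → σ ∈ facesOfSize K s → K σ ≡ true × ∣ σ ∣ ≡ s
  ∈-facesOfSize⁻ {s} {σ} σ∈ =
    let (TKσ , Tsize) =
          Equivalence.to T-∧ (proj₂ (∈-filter⁻ (λ τ → T? (K τ ∧ (∣ τ ∣ ≡ᵇ s))) {xs = allSubsets n} σ∈))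
    in Equivalence.to T-≡ TKσ , ℕ.≡ᵇ⇒≡ ∣ σ ∣ s Tsize

  facesOfSize-unique : ∀ s → Unique (facesOfSize K s)
  facesOfSize-unique s = Unique.filter⁺ (λ τ → T? (K τ ∧ (∣ τ ∣ ≡ᵇ s))) (allSubsets-unique n)

eqSub-≡ : ∀ {n} (x y : Subset n) → eqSub x y ≡ true → x ≡ y
eqSub-≡ []          []          _  = refl
eqSub-≡ (true ∷ x)  (true ∷ y)  eq = cong (true ∷_) (eqSub-≡ x y eq)
eqSub-≡ (false ∷ x) (false ∷ y) eq = cong (false ∷_) (eqSub-≡ x y eq)

eqSub-refl : ∀ {n} (x : Subset n) → eqSub x x ≡ true
eqSub-refl []          = refl
eqSub-refl (true ∷ x)  = eqSub-refl x
eqSub-refl (false ∷ x) = eqSub-refl x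

module _ {A : Set} {P Q : A → Set} (P? : Decidable P) (Q? : Decidable Q) where

  filter-filter : ∀ xs → filter Q? (filter P? xs) ≡ filter (λ x → P? x ×-dec Q? x) xs
  filter-filter []       = refl
  filter-filter (x ∷ xs) with P? x
  ... | no _ = filter-filter xs
  ... | yes _ with Q? x
  ...   | yes _ = cong (x ∷_) (filter-filter xs)
  ...   | no _  = filter-filter xs

module _ {n : ℕ} (K : Cx n) (f : Subset n) where

  private
    T-removeFacet⁻ : ∀ σ b → T (removeFacet K f σ ∧ b) → T (K σ ∧ b) × σ ≢ f
    T-removeFacet⁻ σ b t with K σ | eqSub σ f in σf | b
    ... | true | false | true = t , λ { refl → case trans (sym (eqSub-refl σ)) σf of λ () }

    T-removeFacet⁺ : ∀ σ b → T (K σ ∧ b) × σ ≢ f → T (removeFacet K f σ ∧ b)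
    T-removeFacet⁺ σ b (t , σ≢f) with K σ | eqSub σ f in σf | b
    ... | true | false | true = t
    ... | true | true  | true = ⊥-elim (σ≢f (eqSub-≡ σ f σf))

  facesOfSize-removeFacet : ∀ s → facesOfSize (removeFacet K f) s ≡ facesOfSize K s ─ f
  facesOfSize-removeFacet s = sym (trans
    (filter-filter (λ σ → T? (K σ ∧ (∣ σ ∣ ≡ᵇ s))) (λ σ → ¬? (σ ≟ₛ f)) (allSubsets n))
    (filter-≐ _ _ ((λ {σ} → T-removeFacet⁺ σ _) , (λ {σ} → T-removeFacet⁻ σ _)) (allSubsets n)))

  facesOfSize-removeFacet-≢ : ∀ s → ∣ f ∣ ≢ s → facesOfSize (removeFacet K f) s ≡ facesOfSize K s
  facesOfSize-removeFacet-≢ s ∣f∣≢s =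
    trans (facesOfSize-removeFacet s) (─-∉ λ f∈ → ∣f∣≢s (proj₂ (∈-facesOfSize⁻ K f∈)))

unit-sym : ∀ {n} (ρ σ : Subset n) → unit σ ρ ≡ unit ρ σ
unit-sym ρ σ with ρ ≟ₛ σ | σ ≟ₛ ρ
... | yes _    | yes _    = refl
... | no _     | no _     = refl
... | yes refl | no ρ≢ρ   = ⊥-elim (ρ≢ρ refl)
... | no ρ≢σ   | yes refl = ⊥-elim (ρ≢σ refl)

inc-false-true : ∀ {n} (ρ σ : Subset n) → inc (false ∷ ρ) (true ∷ σ) ≡ unit σ ρ
inc-false-true ρ σ with eqSub ρ σ in ρσ | ρ ≟ₛ σ
... | true  | yes _    = refl
... | true  | no ρ≢σ   = ⊥-elim (ρ≢σ (eqSub-≡ ρ σ ρσ))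
... | false | yes refl = case trans (sym (eqSub-refl ρ)) ρσ of λ ()
... | false | no _     = refl

inc-support : ∀ {n} (ρ σ : Subset n) → inc ρ σ ≢ + 0 → ρ ⊆ σ × ∣ σ ∣ ≡ suc ∣ ρ ∣
inc-support []          []          inc≢0 = ⊥-elim (inc≢0 refl)
inc-support (true ∷ ρ)  (false ∷ σ) inc≢0 = ⊥-elim (inc≢0 refl)
inc-support (false ∷ ρ) (false ∷ σ) inc≢0 =
  let (ρ⊆σ , size) = inc-support ρ σ inc≢0 in out⊆ ρ⊆σ , size
inc-support (true ∷ ρ)  (true ∷ σ)  inc≢0 =
  let (ρ⊆σ , size) = inc-support ρ σ (λ inc≡0 → inc≢0 (cong -_ inc≡0)) in s⊆s ρ⊆σ , cong suc size
inc-support (false ∷ ρ) (true ∷ σ)  inc≢0 with ρ ≟ₛ σ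
... | yes refl = out⊆ ⊆-refl , refl
... | no ρ≢σ   = ⊥-elim (inc≢0 (trans (inc-false-true ρ σ) ([≔]-≢ (λ _ → + 0) (+ 1) ρ≢σ)))

∑-inc-true : ∀ {n} (ρ : Subset n) (h : Subset (suc n) → ℤ) →
  ∑ (allSubsets (suc n)) (λ σ → inc (true ∷ ρ) σ * h σ) ≡ ∑ (allSubsets n) (λ σ → - inc ρ σ * h (true ∷ σ))
∑-inc-true {n} ρ h =
  trans (∑-allSubsets-suc n (λ σ → inc (true ∷ ρ) σ * h σ))
        (trans (cong (_+ ∑ (allSubsets n) (λ σ → - inc ρ σ * h (true ∷ σ)))
                     (∑-zero (allSubsets n) {λ σ → inc (true ∷ ρ) (false ∷ σ) * h (false ∷ σ)} λ _ _ → refl))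
               (ℤ.+-identityˡ _))

∂∘∂≡0 : ∀ n (ρ τ : Subset n) → ∑ (allSubsets n) (λ σ → inc ρ σ * inc σ τ) ≡ + 0
∂∘∂≡0 zero    []          []          = refl
∂∘∂≡0 (suc n) (false ∷ ρ) (false ∷ τ) = begin
  _ ≡⟨ ∑-allSubsets-suc n _ ⟩
  ∑ (allSubsets n) (λ σ → inc ρ σ * inc σ τ) + ∑ (allSubsets n) (λ σ → inc (false ∷ ρ) (true ∷ σ) * + 0)
    ≡⟨ cong₂ _+_ (∂∘∂≡0 n ρ τ) (∑-zero (allSubsets n) λ σ _ → ℤ.*-zeroʳ (inc (false ∷ ρ) (true ∷ σ))) ⟩
  + 0 ∎
  where open ≡-Reasoning
∂∘∂≡0 (suc n) (true ∷ ρ)  (true ∷ τ)  = begin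
  _                                            ≡⟨ ∑-inc-true ρ (λ σ → inc σ (true ∷ τ)) ⟩
  ∑ (allSubsets n) (λ σ → - inc ρ σ * - inc σ τ) ≡⟨ ∑-cong (allSubsets n) (λ σ _ → neg*neg (inc ρ σ) _) ⟩
  ∑ (allSubsets n) (λ σ → inc ρ σ * inc σ τ)     ≡⟨ ∂∘∂≡0 n ρ τ ⟩
  + 0                                          ∎
  where
    open ≡-Reasoning
    neg*neg : ∀ x y → - x * - y ≡ x * y
    neg*neg = solve-∀
∂∘∂≡0 (suc n) (true ∷ ρ)  (false ∷ τ) =
  trans (∑-inc-true ρ (λ σ → inc σ (false ∷ τ))) (∑-zero (allSubsets n) λ σ _ → ℤ.*-zeroʳ (- inc ρ σ))
∂∘∂≡0 (suc n) (false ∷ ρ) (true ∷ τ)  = begin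
  _ ≡⟨ ∑-allSubsets-suc n _ ⟩
  ∑ (allSubsets n) (λ σ → inc ρ σ * inc (false ∷ σ) (true ∷ τ))
    + ∑ (allSubsets n) (λ σ → inc (false ∷ ρ) (true ∷ σ) * - inc σ τ)
    ≡⟨ cong₂ _+_ (trans (∑-cong (allSubsets n) λ σ _ → cong (inc ρ σ *_) (inc-false-true σ τ))
                        (∑-unit (allSubsets n) (inc ρ) (allSubsets-unique n) (allSubsets-complete τ)))
                 (trans (∑-cong (allSubsets n) λ σ _ →
                           trans (cong (_* - inc σ τ) (trans (inc-false-true ρ σ) (unit-sym ρ σ)))
                                 (ℤ.*-comm (unit ρ σ) (- inc σ τ)))
                        (∑-unit (allSubsets n) (λ σ → - inc σ τ) (allSubsets-unique n) (allSubsets-complete ρ))) ⟩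
  inc ρ τ - inc ρ τ
    ≡⟨ ℤ.+-inverseʳ (inc ρ τ) ⟩
  + 0 ∎
  where open ≡-Reasoning

module _ {n : ℕ} {K : Cx n} (K-complex : IsComplex K) where

  ∂∘∂≡0-faces : ∀ {s} ρ₀ {τ} → τ ∈ facesOfSize K (suc (suc s)) →
                ∑ (facesOfSize K (suc s)) (λ ρ → inc ρ₀ ρ * inc ρ τ) ≡ + 0
  ∂∘∂≡0-faces {s} ρ₀ {τ} τ∈ =
    trans (∑-filter (λ σ → T? (K σ ∧ (∣ σ ∣ ≡ᵇ suc s))) (allSubsets n) _)
          (trans (∑-cong (allSubsets n) nonFacesVanish) (∂∘∂≡0 n ρ₀ τ))
    where
      nonFacesVanish : ∀ ρ → ρ ∈ allSubsets n →
        (if K ρ ∧ (∣ ρ ∣ ≡ᵇ suc s) then inc ρ₀ ρ * inc ρ τ else + 0) ≡ inc ρ₀ ρ * inc ρ τ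
      nonFacesVanish ρ _ with K ρ ∧ (∣ ρ ∣ ≡ᵇ suc s) in isFace | inc ρ τ ℤ.≟ + 0
      ... | true  | _         = refl
      ... | false | yes inc≡0 = sym (trans (cong (inc ρ₀ ρ *_) inc≡0) (ℤ.*-zeroʳ (inc ρ₀ ρ)))
      ... | false | no inc≢0  = ⊥-elim (subst T isFace (isFace⁺ K Kρ size))
        where
          ρ⊆τ,size : ρ ⊆ τ × ∣ τ ∣ ≡ suc ∣ ρ ∣
          ρ⊆τ,size = inc-support ρ τ inc≢0
          Kρ : K ρ ≡ true
          Kρ = K-complex ρ τ (proj₁ ρ⊆τ,size) (proj₁ (∈-facesOfSize⁻ K τ∈))
          size : ∣ ρ ∣ ≡ suc s
          size = ℕ.suc-injective (trans (sym (proj₂ ρ⊆τ,size)) (proj₂ (∈-facesOfSize⁻ K τ∈)))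

  rank-+-rank≤ : ∀ {m r₁ r₂} →
    HasRank (facesOfSize K m) (facesOfSize K (suc m)) inc r₁ →
    HasRank (facesOfSize K (suc m)) (facesOfSize K (suc (suc m))) inc r₂ →
    r₁ ℕ.+ r₂ ≤ length (facesOfSize K (suc m))
  rank-+-rank≤ ((L₁ , L₁⊆ , uL₁ , indepL₁ , refl) , _) ((L₂ , L₂⊆ , uL₂ , indepL₂ , refl) , _) =
    MN≡0⇒length-+≤ {M = inc} {N = inc} (facesOfSize-unique K _) L₁⊆ disjoint
      (λ ρ₀ _ τ τ∈L₂ → ∂∘∂≡0-faces ρ₀ (All.lookup L₂⊆ τ∈L₂)) uL₁ indepL₁ uL₂ indepL₂
    where
      disjoint : Disjoint L₁ L₂
      disjoint (σ∈L₁ , σ∈L₂) = ℕ.1+n≢n (trans (sym (proj₂ (∈-facesOfSize⁻ K (All.lookup L₂⊆ σ∈L₂))))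
                                              (proj₂ (∈-facesOfSize⁻ K (All.lookup L₁⊆ σ∈L₁))))

  betti-from-ranks : ∀ {m r₁ r₂} →
    HasRank (facesOfSize K m) (facesOfSize K (suc m)) inc r₁ →
    HasRank (facesOfSize K (suc m)) (facesOfSize K (suc (suc m))) inc r₂ →
    Betti K m (length (facesOfSize K (suc m)) ∸ (r₁ ℕ.+ r₂))
  betti-from-ranks {r₁ = r₁} {r₂} rank₁ rank₂ =
    r₁ , r₂ , rank₁ , rank₂ , trans (ℕ.+-assoc _ r₁ r₂) (ℕ.m∸n+n≡m (rank-+-rank≤ rank₁ rank₂))

module _ {n : ℕ} (K : Cx n) (m : ℕ) where

  open Columns (facesOfSize K (suc m)) inc using (IsColoop; rank-suc⇒coloop; coloop⇒rank-suc)

  private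
    lowerFaces-removeFacet : ∀ {f k} → f ∈ facesOfSize K (suc (suc m)) → k ≤ suc m →
                             facesOfSize (removeFacet K f) k ≡ facesOfSize K k
    lowerFaces-removeFacet {f} {k} f∈ k≤1+m =
      facesOfSize-removeFacet-≢ K f k λ ∣f∣≡k →
        ℕ.>⇒≢ (s≤s k≤1+m) (trans (sym (proj₂ (∈-facesOfSize⁻ K f∈))) ∣f∣≡k)

  bridge⇒coloop : ∀ {f} → IsBridge K (suc m) f → IsColoop (facesOfSize K (suc (suc m))) f
  bridge⇒coloop {f} (f∈ , b , _ , (r₁ , r₂ , rank₁ , rank₂ , size)
                               , (r₁′ , r₂′ , rank₁′ , rank₂′ , size′) , refl) =
    rank-suc⇒coloop rank₂ rank₂″ r₂≡1+r₂′
    where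
      faces₀ : facesOfSize (removeFacet K f) m ≡ facesOfSize K m
      faces₀ = lowerFaces-removeFacet f∈ (ℕ.n≤1+n m)
      faces₁ : facesOfSize (removeFacet K f) (suc m) ≡ facesOfSize K (suc m)
      faces₁ = lowerFaces-removeFacet f∈ ℕ.≤-refl
      r₁≡r₁′ : r₁ ≡ r₁′
      r₁≡r₁′ = Columns.rank-unique (facesOfSize K m) inc rank₁
                 (subst₂ (λ R C → HasRank R C inc r₁′) faces₀ faces₁ rank₁′)
      rank₂″ : HasRank (facesOfSize K (suc m)) (facesOfSize K (suc (suc m)) ─ f) inc r₂′
      rank₂″ = subst₂ (λ R C → HasRank R C inc r₂′) faces₁ (facesOfSize-removeFacet K f _) rank₂′
      r₂≡1+r₂′ : r₂ ≡ suc r₂′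
      r₂≡1+r₂′ = ℕ.+-cancelˡ-≡ (b ℕ.+ r₁) r₂ (suc r₂′) (begin
        b ℕ.+ r₁ ℕ.+ r₂          ≡⟨ size ⟩
        length (facesOfSize K (suc m))            ≡⟨ cong length (sym faces₁) ⟩
        length (facesOfSize (removeFacet K f) (suc m)) ≡⟨ sym size′ ⟩
        suc b ℕ.+ r₁′ ℕ.+ r₂′    ≡⟨ cong (λ r → suc (b ℕ.+ r ℕ.+ r₂′)) (sym r₁≡r₁′) ⟩
        suc (b ℕ.+ r₁ ℕ.+ r₂′)   ≡⟨ sym (ℕ.+-suc (b ℕ.+ r₁) r₂′) ⟩
        b ℕ.+ r₁ ℕ.+ suc r₂′     ∎)
        where open ≡-Reasoning

  coloop⇒¬¬bridge : IsComplex K → ∀ {f} → f ∈ facesOfSize K (suc (suc m)) →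
                    IsColoop (facesOfSize K (suc (suc m))) f → ¬ ¬ IsBridge K (suc m) f
  coloop⇒¬¬bridge K-complex {f} f∈ coloop ¬bridge =
    Columns.rank-exists (facesOfSize K m) inc (facesOfSize K (suc m)) λ (_ , rank₁) →
    Columns.rank-exists (facesOfSize K (suc m)) inc (facesOfSize K (suc (suc m))) λ (_ , rank₂) →
    Columns.rank-exists (facesOfSize K (suc m)) inc (facesOfSize K (suc (suc m)) ─ f) λ (_ , rank₂′) →
    ¬bridge (bridge rank₁ rank₂ rank₂′)
    where
      faces₀ : facesOfSize (removeFacet K f) m ≡ facesOfSize K m
      faces₀ = lowerFaces-removeFacet f∈ (ℕ.n≤1+n m)
      faces₁ : facesOfSize (removeFacet K f) (suc m) ≡ facesOfSize K (suc m)
      faces₁ = lowerFaces-removeFacet f∈ ℕ.≤-refl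
      bridge : ∀ {r₁ r₂ r₂′} →
        HasRank (facesOfSize K m) (facesOfSize K (suc m)) inc r₁ →
        HasRank (facesOfSize K (suc m)) (facesOfSize K (suc (suc m))) inc r₂ →
        HasRank (facesOfSize K (suc m)) (facesOfSize K (suc (suc m)) ─ f) inc r₂′ →
        IsBridge K (suc m) f
      bridge {r₁} {r₂} {r₂′} rank₁ rank₂ rank₂′ =
        f∈ , b , suc b , betti-from-ranks K-complex rank₁ rank₂ , (r₁ , r₂′ , rank₁′ , rank₂″ , size′) , refl
        where
          b : ℕ
          b = length (facesOfSize K (suc m)) ∸ (r₁ ℕ.+ r₂)
          rank₁′ : HasRank (facesOfSize (removeFacet K f) m) (facesOfSize (removeFacet K f) (suc m))
                           inc r₁
          rank₁′ = subst₂ (λ R C → HasRank R C inc r₁) (sym faces₀) (sym faces₁) rank₁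
          rank₂″ : HasRank (facesOfSize (removeFacet K f) (suc m))
                           (facesOfSize (removeFacet K f) (suc (suc m))) inc r₂′
          rank₂″ = subst₂ (λ R C → HasRank R C inc r₂′)
                          (sym faces₁) (sym (facesOfSize-removeFacet K f _)) rank₂′
          size′ : suc b ℕ.+ r₁ ℕ.+ r₂′ ≡ length (facesOfSize (removeFacet K f) (suc m))
          size′ = begin
            suc (b ℕ.+ r₁ ℕ.+ r₂′)   ≡⟨ sym (ℕ.+-suc (b ℕ.+ r₁) r₂′) ⟩
            b ℕ.+ r₁ ℕ.+ suc r₂′
              ≡⟨ cong (b ℕ.+ r₁ ℕ.+_) (sym (coloop⇒rank-suc f∈ coloop rank₂ rank₂′)) ⟩
            b ℕ.+ r₁ ℕ.+ r₂
              ≡⟨ trans (ℕ.+-assoc b r₁ r₂) (ℕ.m∸n+n≡m (rank-+-rank≤ K-complex rank₁ rank₂)) ⟩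
            length (facesOfSize K (suc m))                  ≡⟨ cong length (sym faces₁) ⟩
            length (facesOfSize (removeFacet K f) (suc m))  ∎
            where open ≡-Reasoning

Susp : ∀ {n} → Cx n → Cx (suc (suc n))
Susp K (x ∷ y ∷ σ) = not (x ∧ y) ∧ K σ

module _ {n : ℕ} (K : Cx n) where

  private
    faceOfBase : IsComplex K → ∀ {x′ y′ σ} τ′ → (x′ ∷ y′ ∷ σ) ⊆ τ′ → Susp K τ′ ≡ true → K σ ≡ true
    faceOfBase K-complex {σ = σ} (x ∷ y ∷ τ) sub Sτ =
      K-complex σ τ (drop-∷-⊆ (drop-∷-⊆ sub)) (∧-trueʳ (not (x ∧ y)) Sτ)
      where
        ∧-trueʳ : ∀ a {b} → a ∧ b ≡ true → b ≡ true
        ∧-trueʳ true b≡true = b≡true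

  apex₁ apex₂ : Subset n → Subset (suc (suc n))
  apex₁ σ = true ∷ false ∷ σ
  apex₂ σ = false ∷ true ∷ σ

  Susp-isComplex : IsComplex K → IsComplex (Susp K)
  Susp-isComplex K-complex (true ∷ true ∷ σ) (x ∷ y ∷ τ) sub Sτ with sub here | sub (there here)
  ... | here | there here with () ← Sτ
  Susp-isComplex K-complex (true  ∷ false ∷ σ) τ′ sub Sτ = faceOfBase K-complex τ′ sub Sτ
  Susp-isComplex K-complex (false ∷ _     ∷ σ) τ′ sub Sτ = faceOfBase K-complex τ′ sub Sτ

  Susp-hasDim : ∀ {d} → HasDim K d → HasDim (Susp K) (suc d)
  Susp-hasDim {d} ((σ , Kσ , size) , bounded) = (apex₁ σ , Kσ , cong suc size) , bounded′
    where
      bounded′ : ∀ σ′ → Susp K σ′ ≡ true → ∣ σ′ ∣ ≤ suc (suc d)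
      bounded′ (false ∷ false ∷ σ) Kσ = ℕ.m≤n⇒m≤1+n (bounded σ Kσ)
      bounded′ (true  ∷ false ∷ σ) Kσ = s≤s (bounded σ Kσ)
      bounded′ (false ∷ true  ∷ σ) Kσ = s≤s (bounded σ Kσ)

  apex₁-∈⁺ : ∀ {s σ} → σ ∈ facesOfSize K s → apex₁ σ ∈ facesOfSize (Susp K) (suc s)
  apex₁-∈⁺ σ∈ = let (Kσ , size) = ∈-facesOfSize⁻ K σ∈ in ∈-facesOfSize⁺ (Susp K) Kσ (cong suc size)

  apex₂-∈⁺ : ∀ {s σ} → σ ∈ facesOfSize K s → apex₂ σ ∈ facesOfSize (Susp K) (suc s)
  apex₂-∈⁺ σ∈ = let (Kσ , size) = ∈-facesOfSize⁻ K σ∈ in ∈-facesOfSize⁺ (Susp K) Kσ (cong suc size)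

  apex₁-∈⁻ : ∀ {s σ} → apex₁ σ ∈ facesOfSize (Susp K) (suc s) → σ ∈ facesOfSize K s
  apex₁-∈⁻ σ∈ = let (Kσ , size) = ∈-facesOfSize⁻ (Susp K) σ∈ in ∈-facesOfSize⁺ K Kσ (ℕ.suc-injective size)

  apex₂-∈⁻ : ∀ {s σ} → apex₂ σ ∈ facesOfSize (Susp K) (suc s) → σ ∈ facesOfSize K s
  apex₂-∈⁻ σ∈ = let (Kσ , size) = ∈-facesOfSize⁻ (Susp K) σ∈ in ∈-facesOfSize⁺ K Kσ (ℕ.suc-injective size)

  ∑-facesOfSize-Susp : ∀ s (h : Subset (suc (suc n)) → ℤ) →
    ∑ (facesOfSize (Susp K) (suc s)) h
      ≡ ∑ (facesOfSize K (suc s)) (λ σ → h (false ∷ false ∷ σ))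
        + ∑ (facesOfSize K s) (λ σ → h (apex₂ σ)) + ∑ (facesOfSize K s) (λ σ → h (apex₁ σ))
  ∑-facesOfSize-Susp s h = begin
    ∑ (facesOfSize (Susp K) (suc s)) h
      ≡⟨ ∑-filter (λ σ → T? (Susp K σ ∧ (∣ σ ∣ ≡ᵇ suc s))) (allSubsets (suc (suc n))) h ⟩
    ∑ (allSubsets (suc (suc n))) restricted
      ≡⟨ ∑-allSubsets-suc (suc n) restricted ⟩
    ∑ (allSubsets (suc n)) (λ σ → restricted (false ∷ σ))
      + ∑ (allSubsets (suc n)) (λ σ → restricted (true ∷ σ))
      ≡⟨ cong₂ _+_ (∑-allSubsets-suc n (λ σ → restricted (false ∷ σ)))
                   (∑-allSubsets-suc n (λ σ → restricted (true ∷ σ))) ⟩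
    (∑ (allSubsets n) (λ σ → if K σ ∧ (∣ σ ∣ ≡ᵇ suc s) then h (false ∷ false ∷ σ) else + 0)
      + ∑ (allSubsets n) (λ σ → if K σ ∧ (∣ σ ∣ ≡ᵇ s) then h (apex₂ σ) else + 0))
    + (∑ (allSubsets n) (λ σ → if K σ ∧ (∣ σ ∣ ≡ᵇ s) then h (apex₁ σ) else + 0)
      + ∑ (allSubsets n) (λ σ → + 0))
      ≡⟨ sym (cong₂ _+_ (cong₂ _+_ (∑-filter (isFace (suc s)) (allSubsets n) _)
                                   (∑-filter (isFace s) (allSubsets n) _))
                        (cong₂ _+_ (∑-filter (isFace s) (allSubsets n) _)
                                   (sym (∑-zero (allSubsets n) λ _ _ → refl)))) ⟩
    (∑ (facesOfSize K (suc s)) (λ σ → h (false ∷ false ∷ σ)) + ∑ (facesOfSize K s) (λ σ → h (apex₂ σ)))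
    + (∑ (facesOfSize K s) (λ σ → h (apex₁ σ)) + + 0)
      ≡⟨ cong (_+_ (∑ (facesOfSize K (suc s)) (λ σ → h (false ∷ false ∷ σ))
                    + ∑ (facesOfSize K s) (λ σ → h (apex₂ σ))))
              (ℤ.+-identityʳ _) ⟩
    ∑ (facesOfSize K (suc s)) (λ σ → h (false ∷ false ∷ σ))
      + ∑ (facesOfSize K s) (λ σ → h (apex₂ σ)) + ∑ (facesOfSize K s) (λ σ → h (apex₁ σ)) ∎
    where
      open ≡-Reasoning
      restricted : Subset (suc (suc n)) → ℤ
      restricted σ = if Susp K σ ∧ (∣ σ ∣ ≡ᵇ suc s) then h σ else + 0
      isFace : ∀ s σ → Dec (T (K σ ∧ (∣ σ ∣ ≡ᵇ s)))
      isFace s σ = T? (K σ ∧ (∣ σ ∣ ≡ᵇ s))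

  colComb-Susp-apex₁ : ∀ d (φ : Subset (suc (suc n)) → ℤ) ρ →
    colComb inc (facesOfSize (Susp K) (suc (suc d))) φ (apex₁ ρ)
      ≡ - colComb inc (facesOfSize K (suc d)) (φ ∘ apex₁) ρ
  colComb-Susp-apex₁ d φ ρ = begin
    colComb inc (facesOfSize (Susp K) (suc (suc d))) φ (apex₁ ρ)
      ≡⟨ ∑-facesOfSize-Susp (suc d) (λ σ′ → inc (apex₁ ρ) σ′ * φ σ′) ⟩
    ∑ (facesOfSize K (suc (suc d))) (λ σ → + 0) + ∑ (facesOfSize K (suc d)) (λ σ → + 0)
      + ∑ (facesOfSize K (suc d)) (λ σ → - inc ρ σ * φ (apex₁ σ))
      ≡⟨ cong (_+ ∑ (facesOfSize K (suc d)) (λ σ → - inc ρ σ * φ (apex₁ σ)))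
              (cong₂ _+_ (∑-zero (facesOfSize K (suc (suc d))) λ _ _ → refl)
                         (∑-zero (facesOfSize K (suc d)) λ _ _ → refl)) ⟩
    + 0 + + 0 + ∑ (facesOfSize K (suc d)) (λ σ → - inc ρ σ * φ (apex₁ σ))
      ≡⟨ ℤ.+-identityˡ _ ⟩
    ∑ (facesOfSize K (suc d)) (λ σ → - inc ρ σ * φ (apex₁ σ))
      ≡⟨ ∑-cong (facesOfSize K (suc d)) (λ σ _ → sym (ℤ.neg-distribˡ-* (inc ρ σ) (φ (apex₁ σ)))) ⟩
    ∑ (facesOfSize K (suc d)) (λ σ → - (inc ρ σ * φ (apex₁ σ)))
      ≡⟨ ∑-neg (facesOfSize K (suc d)) (λ σ → inc ρ σ * φ (apex₁ σ)) ⟩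
    - colComb inc (facesOfSize K (suc d)) (φ ∘ apex₁) ρ ∎
    where open ≡-Reasoning

  Susp-flow⇒flow : ∀ {d q} → NZFlow (Susp K) (suc d) q → NZFlow K d q
  Susp-flow⇒flow {d} {q} (φ , φ<q , φ≢0 , φ-cycle) =
    φ ∘ apex₁ , (λ σ σ∈ → φ<q _ (apex₁-∈⁺ σ∈)) , (λ σ σ∈ → φ≢0 _ (apex₁-∈⁺ σ∈)) , cycle
    where
      cycle : ∀ ρ → ρ ∈ facesOfSize K d →
              (+ q) ∣ℤ colComb inc (facesOfSize K (suc d)) (λ σ → + φ (apex₁ σ)) ρ
      cycle ρ ρ∈ =
        subst (q ∣ℕ_) (ℤ.∣-i∣≡∣i∣ (colComb inc (facesOfSize K (suc d)) (λ σ → + φ (apex₁ σ)) ρ))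
          (subst ((+ q) ∣ℤ_) (colComb-Susp-apex₁ d (λ σ → + φ σ) ρ) (φ-cycle (apex₁ ρ) (apex₁-∈⁺ ρ∈)))

  suspend : (Subset n → ℤ) → Subset (suc (suc n)) → ℤ
  suspend a (true  ∷ false ∷ σ) = a σ
  suspend a (false ∷ true  ∷ σ) = - a σ
  suspend a (true  ∷ true  ∷ σ) = + 0
  suspend a (false ∷ false ∷ σ) = + 0

  suspendList : List (Subset n) → List (Subset (suc (suc n)))
  suspendList D = map apex₁ D ++ map apex₂ D

  colComb-suspend : ∀ D a ρ′ → colComb inc (suspendList D) (suspend a) ρ′
                      ≡ ∑ D (λ σ → inc ρ′ (apex₁ σ) * a σ) + ∑ D (λ σ → inc ρ′ (apex₂ σ) * - a σ)
  colComb-suspend D a ρ′ =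
    trans (∑-++ (map apex₁ D) (map apex₂ D) _)
          (cong₂ _+_ (∑-map apex₁ D _) (∑-map apex₂ D _))

  suspend-relation : ∀ {m D a} → IsRelation (facesOfSize K (suc m)) inc D a →
    IsRelation (facesOfSize (Susp K) (suc (suc m))) inc (suspendList D) (suspend a)
  suspend-relation {m} {D} {a} rel (false ∷ false ∷ ρ) _ =
    trans (colComb-suspend D a (false ∷ false ∷ ρ))
      (trans (sym (∑-distrib-+ D _ _))
             (∑-zero D λ σ _ → trans (cong (λ u → inc (false ∷ false ∷ ρ) (apex₁ σ) * a σ + u * - a σ)
                                              (sym (inc-base-apex ρ σ)))
                                     (cancel (inc (false ∷ false ∷ ρ) (apex₁ σ)) (a σ))))
    where
      cancel : ∀ u x → u * x + u * - x ≡ + 0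
      cancel = solve-∀
      inc-base-apex : ∀ ρ σ → inc (false ∷ false ∷ ρ) (apex₁ σ) ≡ inc (false ∷ false ∷ ρ) (apex₂ σ)
      inc-base-apex ρ σ with eqSub ρ σ
      ... | true  = refl
      ... | false = refl
  suspend-relation {m} {D} {a} rel (true ∷ false ∷ ρ) ρ′∈ = begin
    colComb inc (suspendList D) (suspend a) (apex₁ ρ)
      ≡⟨ colComb-suspend D a (apex₁ ρ) ⟩
    ∑ D (λ σ → - inc ρ σ * a σ) + ∑ D (λ σ → + 0)
      ≡⟨ cong₂ _+_ (∑-cong D λ σ _ → sym (ℤ.neg-distribˡ-* (inc ρ σ) (a σ))) (∑-zero D λ _ _ → refl) ⟩
    ∑ D (λ σ → - (inc ρ σ * a σ)) + + 0
      ≡⟨ trans (ℤ.+-identityʳ _) (∑-neg D _) ⟩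
    - colComb inc D a ρ
      ≡⟨ cong -_ (rel ρ (apex₁-∈⁻ ρ′∈)) ⟩
    + 0 ∎
    where open ≡-Reasoning
  suspend-relation {m} {D} {a} rel (false ∷ true ∷ ρ) ρ′∈ = begin
    colComb inc (suspendList D) (suspend a) (apex₂ ρ)
      ≡⟨ colComb-suspend D a (apex₂ ρ) ⟩
    ∑ D (λ σ → + 0) + ∑ D (λ σ → - inc ρ σ * - a σ)
      ≡⟨ cong₂ _+_ (∑-zero D λ _ _ → refl) (∑-cong D λ σ _ → neg*neg (inc ρ σ) (a σ)) ⟩
    + 0 + colComb inc D a ρ
      ≡⟨ ℤ.+-identityˡ _ ⟩
    colComb inc D a ρ
      ≡⟨ rel ρ (apex₂-∈⁻ ρ′∈) ⟩
    + 0 ∎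
    where
      open ≡-Reasoning
      neg*neg : ∀ x y → - x * - y ≡ x * y
      neg*neg = solve-∀
  suspend-relation rel (true ∷ true ∷ ρ) ρ′∈ with () ← proj₁ (∈-facesOfSize⁻ (Susp K) ρ′∈)

  suspendList-unique : ∀ {D} → Unique D → Unique (suspendList D)
  suspendList-unique uD =
    Unique.++⁺ (Unique.map⁺ (λ { refl → refl }) uD) (Unique.map⁺ (λ { refl → refl }) uD)
               λ (σ∈₁ , σ∈₂) → apexesDiffer (∈-map⁻ apex₁ σ∈₁) (∈-map⁻ apex₂ σ∈₂)
    where
      apexesDiffer : ∀ {D σ′} → ∃ (λ σ → σ ∈ D × σ′ ≡ apex₁ σ) →
                     ∃ (λ σ → σ ∈ D × σ′ ≡ apex₂ σ) → ⊥
      apexesDiffer (_ , _ , refl) (_ , _ , ())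

  Susp-coloop⇒coloop : ∀ {m g f} → f ≡ apex₁ g ⊎ f ≡ apex₂ g →
    Columns.IsColoop (facesOfSize (Susp K) (suc (suc m))) inc (facesOfSize (Susp K) (suc (suc (suc m)))) f →
    Columns.IsColoop (facesOfSize K (suc m)) inc (facesOfSize K (suc (suc m))) g
  Susp-coloop⇒coloop {m} {g} f≡apex coloop D a uD D⊆ rel g∈D =
    apexCoefficient f≡apex (coloop (suspendList D) (suspend a) (suspendList-unique uD) D′⊆
                                   (suspend-relation {D = D} {a} rel) (f∈D′ f≡apex))
    where
      D′⊆ : All (_∈ facesOfSize (Susp K) (suc (suc (suc m)))) (suspendList D)
      D′⊆ = All.++⁺ (All.map⁺ (All.map apex₁-∈⁺ D⊆)) (All.map⁺ (All.map apex₂-∈⁺ D⊆))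
      f∈D′ : ∀ {f} → f ≡ apex₁ g ⊎ f ≡ apex₂ g → f ∈ suspendList D
      f∈D′ (inj₁ refl) = ∈-++⁺ˡ (∈-map⁺ apex₁ g∈D)
      f∈D′ (inj₂ refl) = ∈-++⁺ʳ (map apex₁ D) (∈-map⁺ apex₂ g∈D)
      apexCoefficient : ∀ {f} → f ≡ apex₁ g ⊎ f ≡ apex₂ g → suspend a f ≡ + 0 → a g ≡ + 0
      apexCoefficient (inj₁ refl) ag≡0  = ag≡0
      apexCoefficient (inj₂ refl) -ag≡0 = trans (sym (ℤ.neg-involutive (a g))) (cong -_ -ag≡0)

  Susp-facet : ∀ {m f} → HasDim K (suc m) → f ∈ facesOfSize (Susp K) (suc (suc (suc m))) →
               ∃ λ g → (f ≡ apex₁ g ⊎ f ≡ apex₂ g) × g ∈ facesOfSize K (suc (suc m))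
  Susp-facet {f = true  ∷ false ∷ g} _ f∈ = g , inj₁ refl , apex₁-∈⁻ f∈
  Susp-facet {f = false ∷ true  ∷ g} _ f∈ = g , inj₂ refl , apex₂-∈⁻ f∈
  Susp-facet {f = true  ∷ true  ∷ g} _ f∈ with () ← proj₁ (∈-facesOfSize⁻ (Susp K) f∈)
  Susp-facet {f = false ∷ false ∷ g} (_ , bounded) f∈ =
    let (Kg , size) = ∈-facesOfSize⁻ (Susp K) f∈ in ⊥-elim (ℕ.1+n≰n (subst (_≤ _) size (bounded g Kg)))

  Susp-bridgeless : ∀ {m} → IsComplex K → HasDim K (suc m) → Bridgeless K (suc m) →
                    Bridgeless (Susp K) (suc (suc m))
  Susp-bridgeless {m} K-complex dim bridgeless f bridge =
    let (g , f≡apex , g∈) = Susp-facet dim (proj₁ bridge)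
    in coloop⇒¬¬bridge K m K-complex g∈
         (Susp-coloop⇒coloop f≡apex (bridge⇒coloop (Susp K) (suc m) bridge))
         (bridgeless g)

proposition4p1 : ∀ (d : ℕ) → 1 ≤ d → ∀ (B : ℕ) → FlowBound (suc d) B → FlowBound d B
proposition4p1 (suc m) _ B flowBound n K K-complex dim bridgeless =
  let (q , 1≤q , q≤B , flow) = flowBound (suc (suc n)) (Susp K) (Susp-isComplex K K-complex)
                                          (Susp-hasDim K dim) (Susp-bridgeless K K-complex dim bridgeless)
  in q , 1≤q , q≤B , Susp-flow⇒flow K flow
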